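{- If $T$ is a directed tree, then $\rho(T)=\gamma(T)$.
   Context: A directed tree is an orientation of a (finite) tree, i.e., a digraph with no pair of opposite arcs whose underlying graph is a tree. For a vertex $v$ of a digraph $D$, $N^+[v]=\{v\}\cup\{u:(v,u)\in A(D)\}$. A set $S\subseteq V(D)$ is a dominating set of $D$ if every vertex of $V(D)\setminus S$ has an in-neighbor in $S$; $\gamma(D)$ is the minimum size of a dominating set. A set $B\subseteq V(D)$ is a packing in $D$ if $|N^+[v]\cap B|\le 1$ for every $v\in V(D)$; $\rho(D)$ is the maximum size of a packing in $D$. -}

module Defs where

open import Data.Nat using (ℕ; suc; _≤_)
open import Data.Bool using (Bool; true; _∨_)
open import Data.Fin using (Fin; _≟_)
open import Data.Fin.Subset using (Subset; _∈_; _∉_; _∩_; ∣_∣)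
open import Data.Vec using (tabulate)
open import Data.List using (List; []; _∷_; _++_; length)
open import Data.List.Relation.Unary.Unique.Propositional using (Unique)
open import Data.Product using (_×_; ∃; ∃-syntax)
open import Data.Sum using (_⊎_)
open import Data.Unit using (⊤)
open import Relation.Nullary using (¬_)
open import Relation.Nullary.Decidable using (⌊_⌋)
open import Relation.Binary.PropositionalEquality using (_≡_)
open import Relation.Binary.Construct.Closure.ReflexiveTransitive using (Star)

Digraph : ℕ → Set
Digraph n = Fin n → Fin n → Bool

module _ {n : ℕ} (D : Digraph n) where

  Arc : Fin n → Fin n → Set
  Arc u v = D u v ≡ true

  Adj : Fin n → Fin n → Set
  Adj u v = Arc u v ⊎ Arc v u

  Chain : Fin n → List (Fin n) → Set
  Chain x [] = ⊤
  Chain x (y ∷ ys) = Adj x y × Chain y ys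

  HasCycle : Set
  HasCycle = ∃[ v ] ∃[ vs ] (2 ≤ length vs × Unique (v ∷ vs) × Chain v (vs ++ v ∷ []))

  Connected : Set
  Connected = ∀ u v → Star Adj u v

  -- the underlying graph is a tree: connected and acyclic
  -- (the vertex set is required to be nonempty in IsDirectedTree below)
  UnderlyingTree : Set
  UnderlyingTree = Connected × ¬ HasCycle

  N⁺[_] : Fin n → Subset n
  N⁺[ v ] = tabulate (λ u → ⌊ u ≟ v ⌋ ∨ D v u)

  IsDominating : Subset n → Set
  IsDominating S = ∀ v → v ∉ S → ∃[ u ] (u ∈ S × Arc u v)

  IsPacking : Subset n → Set
  IsPacking B = ∀ v → ∣ N⁺[ v ] ∩ B ∣ ≤ 1

  IsDominationNumber : ℕ → Set
  IsDominationNumber k =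
    (∃[ S ] (IsDominating S × ∣ S ∣ ≡ k)) × (∀ S → IsDominating S → k ≤ ∣ S ∣)

  IsPackingNumber : ℕ → Set
  IsPackingNumber k =
    (∃[ B ] (IsPacking B × ∣ B ∣ ≡ k)) × (∀ B → IsPacking B → ∣ B ∣ ≤ k)

-- a directed tree: an orientation of a finite tree (no loops, no pair of opposite arcs,
-- underlying graph a tree); a tree has at least one vertex
IsDirectedTree : ∀ {n} → Digraph n → Set
IsDirectedTree {n} D =
  (∃ λ m → n ≡ suc m)
  × (∀ v → ¬ Arc D v v)
  × (∀ u v → Arc D u v → ¬ Arc D v u)
  × UnderlyingTree D

-- A packing B and a dominating set S satisfy ∣ B ∣ ≤ ∣ S ∣, since each vertex of S dominates at
-- most one vertex of B.  Conversely, when the underlying graph is acyclic, every nonempty set U of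
-- vertices still to be dominated contains a vertex h with a dominator s whose closed out-neighbourhood
-- contains every vertex of U dominated together with h: extend a path through U until no vertex of U
-- lies within distance two beyond its end h, and take s to be h or its predecessor on the path.
-- Putting h into B and s into S and recursing on U ─ N⁺[ s ] builds a packing and a dominating set
-- of equal size.
module Submission where

open import Defs
open import Data.Nat using (ℕ; suc; _≤_; _<_; _+_; _∸_; z≤n; s≤s)
open import Data.Nat.Properties
  using (≤-refl; ≤-reflexive; ≤-trans; ≤-antisym; <-trans; n≤1+n; +-suc; +-mono-≤; +-monoʳ-≤; ∸-monoʳ-<; module ≤-Reasoning)
open import Data.Nat.Induction using (<-wellFounded)
open import Data.Bool using (Bool; true; _∨_)
import Data.Bool as Bool
open import Data.Bool.Properties using (∨-zeroʳ)
open import Data.Fin using (Fin; zero; suc; _≟_)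
open import Data.Fin.Properties using (any?; injective⇒≤)
open import Data.Fin.Subset using (Subset; _∈_; _∉_; _⊆_; _⊂_; _∩_; _∪_; _─_; _-_; ⁅_⁆; ∣_∣; Nonempty; inside; outside)
  renaming (⊥ to ∅; ⊤ to Full)
open import Data.Fin.Subset.Properties
  using (_∈?_; nonempty?; ⊥⊆; x∈⁅x⁆; x∈⁅y⁆⇒x≡y; ∣⁅x⁆∣≡1; ∣⊥∣≡0; ∈⊤; p⊆q⇒∣p∣≤∣q∣; p⊂q⇒∣p∣<∣q∣; ∣p∩q∣≤∣q∣;
         x∈p∩q⁺; x∈p∩q⁻; x∈p∪q⁺; x∈p∪q⁻; q⊆p∪q; x∈p∧x∉q⇒x∈p─q; p─q⊆p; p∩q≢∅⇒p─q⊂p;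
         x∈p∧x≢y⇒x∈p-y; x∈p⇒p-x⊂p; x∈p⇒∣p-x∣<∣p∣)
open import Data.Fin.Subset.Induction using (⊂-wellFounded)
open import Data.Vec using ([]; _∷_; tabulate; here; there)
open import Data.Vec.Properties using (lookup∘tabulate; []=⇒lookup; lookup⇒[]=)
open import Data.List using (List; []; _∷_; _++_; [_]; length; lookup)
open import Data.List.Properties using (++-assoc)
open import Data.List.Membership.Propositional using () renaming (_∈_ to _∈ˡ_)
open import Data.List.Membership.Propositional.Properties using (∈-∃++; ∈-lookup)
open import Data.List.Relation.Unary.All as All using ([]; _∷_)
open import Data.List.Relation.Unary.All.Properties using (¬Any⇒All¬; ++⁻ˡ; ++⁻ʳ)
open import Data.List.Relation.Unary.Any using (here; there)
open import Data.List.Relation.Unary.AllPairs using ([]; _∷_)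
open import Data.List.Relation.Unary.Unique.Propositional using (Unique)
open import Data.Product using (_×_; _,_; ∃-syntax)
open import Data.Sum using (_⊎_; inj₁; inj₂)
open import Data.Unit using (tt)
open import Data.Empty using (⊥)
open import Induction.WellFounded using (Acc; acc)
open import Relation.Nullary using (¬_; Dec; yes; no; ¬?; contradiction)
open import Relation.Nullary.Decidable using (⌊_⌋; _×-dec_; _⊎-dec_; isYes≗does; dec-true; dec-false)
open import Relation.Binary.PropositionalEquality using (_≡_; _≢_; refl; sym; trans; cong; subst; subst₂; ≢-sym)

private
  variable
    n : ℕ

∣p∪q∣≤∣p∣+∣q∣ : (p q : Subset n) → ∣ p ∪ q ∣ ≤ ∣ p ∣ + ∣ q ∣
∣p∪q∣≤∣p∣+∣q∣ []            []            = z≤n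
∣p∪q∣≤∣p∣+∣q∣ (outside ∷ p) (outside ∷ q) = ∣p∪q∣≤∣p∣+∣q∣ p q
∣p∪q∣≤∣p∣+∣q∣ (outside ∷ p) (inside  ∷ q) =
  ≤-trans (s≤s (∣p∪q∣≤∣p∣+∣q∣ p q)) (≤-reflexive (sym (+-suc ∣ p ∣ ∣ q ∣)))
∣p∪q∣≤∣p∣+∣q∣ (inside  ∷ p) (outside ∷ q) = s≤s (∣p∪q∣≤∣p∣+∣q∣ p q)
∣p∪q∣≤∣p∣+∣q∣ (inside  ∷ p) (inside  ∷ q) =
  s≤s (≤-trans (∣p∪q∣≤∣p∣+∣q∣ p q) (+-monoʳ-≤ ∣ p ∣ (n≤1+n ∣ q ∣)))

∣⁅x⁆∪p∣≤1+∣p∣ : (x : Fin n) (p : Subset n) → ∣ ⁅ x ⁆ ∪ p ∣ ≤ suc ∣ p ∣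
∣⁅x⁆∪p∣≤1+∣p∣ x p = ≤-trans (∣p∪q∣≤∣p∣+∣q∣ ⁅ x ⁆ p) (≤-reflexive (cong (_+ ∣ p ∣) (∣⁅x⁆∣≡1 x)))

x∈p─q⇒x∉q : {x : Fin n} {p q : Subset n} → x ∈ p ─ q → x ∉ q
x∈p─q⇒x∉q {x = zero}  {_ ∷ _} {outside ∷ _} here ()
x∈p─q⇒x∉q {x = suc _} {_ ∷ p} {_ ∷ q}       (there x∈p─q) (there x∈q) = x∈p─q⇒x∉q {p = p} {q} x∈p─q x∈q

∣p∣≤∣q∩p∣+∣p─q∣ : (p q : Subset n) → ∣ p ∣ ≤ ∣ q ∩ p ∣ + ∣ p ─ q ∣
∣p∣≤∣q∩p∣+∣p─q∣ p q = ≤-trans (p⊆q⇒∣p∣≤∣q∣ split) (∣p∪q∣≤∣p∣+∣q∣ (q ∩ p) (p ─ q))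
  where
  split : p ⊆ q ∩ p ∪ (p ─ q)
  split {x} x∈p with x ∈? q
  ... | yes x∈q = x∈p∪q⁺ (inj₁ (x∈p∩q⁺ (x∈q , x∈p)))
  ... | no  x∉q = x∈p∪q⁺ (inj₂ (x∈p∧x∉q⇒x∈p─q x∈p x∉q))

∈tabulate⁻ : {f : Fin n → Bool} {x : Fin n} → x ∈ tabulate f → f x ≡ true
∈tabulate⁻ {f = f} {x} x∈ = trans (sym (lookup∘tabulate f x)) ([]=⇒lookup x∈)

∈tabulate⁺ : {f : Fin n → Bool} {x : Fin n} → f x ≡ true → x ∈ tabulate f
∈tabulate⁺ {f = f} {x} fx = lookup⇒[]= x _ (trans (lookup∘tabulate f x) fx)

lookup-injective : {xs : List (Fin n)} → Unique xs → ∀ {i j} → lookup xs i ≡ lookup xs j → i ≡ j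
lookup-injective (x∉xs ∷ _)  {zero}  {zero}  _  = refl
lookup-injective (x∉xs ∷ _)  {zero}  {suc j} eq = contradiction eq (All.lookup x∉xs (∈-lookup j))
lookup-injective (x∉xs ∷ _)  {suc i} {zero}  eq = contradiction (sym eq) (All.lookup x∉xs (∈-lookup i))
lookup-injective (_ ∷ uniq) {suc i} {suc j} eq = cong suc (lookup-injective uniq eq)

Unique⇒length≤n : {xs : List (Fin n)} → Unique xs → length xs ≤ n
Unique⇒length≤n uniq = injective⇒≤ (lookup-injective uniq)

Unique[xs++x∷ys]⇒Unique[x∷xs] : {A : Set} (xs : List A) {x : A} {ys : List A} →
                                 Unique (xs ++ x ∷ ys) → Unique (x ∷ xs)
Unique[xs++x∷ys]⇒Unique[x∷xs] []       (_ ∷ _)       = [] ∷ []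
Unique[xs++x∷ys]⇒Unique[x∷xs] (y ∷ xs) (y∉ ∷ uniq) with Unique[xs++x∷ys]⇒Unique[x∷xs] xs uniq
... | x∉xs ∷ uniq′ = ((λ x≡y → All.head (++⁻ʳ xs y∉) (sym x≡y)) ∷ x∉xs) ∷ ++⁻ˡ xs y∉ ∷ uniq′

module _ (D : Digraph n) where

  private
    N⁺ : Fin n → Subset n
    N⁺ = N⁺[_] D

  arc? : ∀ u v → Dec (Arc D u v)
  arc? u v = D u v Bool.≟ true

  adj? : ∀ u v → Dec (Adj D u v)
  adj? u v = arc? u v ⊎-dec arc? v u

  Adj-sym : ∀ {u v} → Adj D u v → Adj D v u
  Adj-sym (inj₁ uv) = inj₂ uv
  Adj-sym (inj₂ vu) = inj₁ vu

  v∈N⁺[v] : ∀ v → v ∈ N⁺ v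
  v∈N⁺[v] v = ∈tabulate⁺ (cong (_∨ D v v) (trans (isYes≗does (v ≟ v)) (dec-true (v ≟ v) refl)))

  arc⇒∈N⁺ : ∀ {v x} → Arc D v x → x ∈ N⁺ v
  arc⇒∈N⁺ {v} {x} vx = ∈tabulate⁺ (trans (cong (⌊ x ≟ v ⌋ ∨_) vx) (∨-zeroʳ _))

  ∈N⁺⇒arc : ∀ {v x} → x ∈ N⁺ v → x ≢ v → Arc D v x
  ∈N⁺⇒arc {v} {x} x∈ x≢v =
    trans (cong (_∨ D v x) (sym (trans (isYes≗does (x ≟ v)) (dec-false (x ≟ v) x≢v)))) (∈tabulate⁻ x∈)

  Covers : Subset n → Subset n → Set
  Covers S U = ∀ {x} → x ∈ U → ∃[ s ] (s ∈ S × x ∈ N⁺ s)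

  dominating⇒covers : ∀ {S U} → IsDominating D S → Covers S U
  dominating⇒covers {S} S-dom {x} _ with x ∈? S
  ... | yes x∈S = x , x∈S , v∈N⁺[v] x
  ... | no  x∉S with S-dom x x∉S
  ...   | s , s∈S , sx = s , s∈S , arc⇒∈N⁺ sx

  covers⇒dominating : ∀ {S} → Covers S Full → IsDominating D S
  covers⇒dominating S-covers x x∉S with S-covers (∈⊤ {x = x})
  ... | s , s∈S , x∈N⁺s with x ≟ s
  ...   | yes refl = contradiction s∈S x∉S
  ...   | no  x≢s  = s , s∈S , ∈N⁺⇒arc x∈N⁺s x≢s

  IsPacking-⊆ : ∀ {B B′} → B′ ⊆ B → IsPacking D B → IsPacking D B′
  IsPacking-⊆ {B} {B′} B′⊆B B-packing v = ≤-trans (p⊆q⇒∣p∣≤∣q∣ shrink) (B-packing v)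
    where
    shrink : N⁺ v ∩ B′ ⊆ N⁺ v ∩ B
    shrink x∈ with x∈p∩q⁻ (N⁺ v) B′ x∈
    ... | x∈N⁺v , x∈B′ = x∈p∩q⁺ (x∈N⁺v , B′⊆B x∈B′)

  ∅-packing : IsPacking D ∅
  ∅-packing v = ≤-trans (∣p∩q∣≤∣q∣ (N⁺ v) ∅) (≤-trans (≤-reflexive (∣⊥∣≡0 n)) z≤n)

  IsPacking-⁅x⁆∪ : ∀ {x B} → IsPacking D B → (∀ {v y} → x ∈ N⁺ v → y ∈ N⁺ v → y ∉ B) →
                   IsPacking D (⁅ x ⁆ ∪ B)
  IsPacking-⁅x⁆∪ {x} {B} B-packing separated v with x ∈? N⁺ v
  ... | yes x∈N⁺v = ≤-trans (p⊆q⇒∣p∣≤∣q∣ only-x) (≤-reflexive (∣⁅x⁆∣≡1 x))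
    where
    only-x : N⁺ v ∩ (⁅ x ⁆ ∪ B) ⊆ ⁅ x ⁆
    only-x y∈ with x∈p∩q⁻ (N⁺ v) _ y∈
    ... | y∈N⁺v , y∈B′ with x∈p∪q⁻ ⁅ x ⁆ B y∈B′
    ...   | inj₁ y∈⁅x⁆ = y∈⁅x⁆
    ...   | inj₂ y∈B   = contradiction y∈B (separated x∈N⁺v y∈N⁺v)
  ... | no x∉N⁺v = ≤-trans (p⊆q⇒∣p∣≤∣q∣ within-B) (B-packing v)
    where
    within-B : N⁺ v ∩ (⁅ x ⁆ ∪ B) ⊆ N⁺ v ∩ B
    within-B y∈ with x∈p∩q⁻ (N⁺ v) _ y∈
    ... | y∈N⁺v , y∈B′ with x∈p∪q⁻ ⁅ x ⁆ B y∈B′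
    ...   | inj₁ y∈⁅x⁆ = contradiction (subst (_∈ N⁺ v) (x∈⁅y⁆⇒x≡y x y∈⁅x⁆) y∈N⁺v) x∉N⁺v
    ...   | inj₂ y∈B   = x∈p∩q⁺ (y∈N⁺v , y∈B)

  ∣packing∣≤∣cover∣ : ∀ {B} S → IsPacking D B → Covers S B → ∣ B ∣ ≤ ∣ S ∣
  ∣packing∣≤∣cover∣ S = go S (⊂-wellFounded S)
    where
    go : ∀ {B} S → Acc _⊂_ S → IsPacking D B → Covers S B → ∣ B ∣ ≤ ∣ S ∣
    go {B} S (acc rec) B-packing S-covers with nonempty? S
    ... | no S-empty = p⊆q⇒∣p∣≤∣q∣ {q = S} λ x∈B →
            let (s , s∈S , _) = S-covers x∈B in contradiction (s , s∈S) S-empty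
    ... | yes (s , s∈S) = begin
            ∣ B ∣                         ≤⟨ ∣p∣≤∣q∩p∣+∣p─q∣ B (N⁺ s) ⟩
            ∣ N⁺ s ∩ B ∣ + ∣ B ─ N⁺ s ∣  ≤⟨ +-mono-≤ (B-packing s) rest ⟩
            suc ∣ S - s ∣                 ≤⟨ x∈p⇒∣p-x∣<∣p∣ s∈S ⟩
            ∣ S ∣                         ∎
      where
      open ≤-Reasoning
      rest-covered : Covers (S - s) (B ─ N⁺ s)
      rest-covered x∈ with S-covers (p─q⊆p B (N⁺ s) x∈)
      ... | s′ , s′∈S , x∈N⁺s′ =
        s′ , x∈p∧x≢y⇒x∈p-y s′∈S (λ { refl → x∈p─q⇒x∉q x∈ x∈N⁺s′ }) , x∈N⁺s′
      rest : ∣ B ─ N⁺ s ∣ ≤ ∣ S - s ∣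
      rest = go (S - s) (rec (x∈p⇒p-x⊂p s∈S)) (IsPacking-⊆ (p─q⊆p B (N⁺ s)) B-packing) rest-covered

  -- A path is kept as the reversed list h ∷ t of its vertices, h being its current end;
  -- the head of t, if any, is the vertex preceding h.
  Prev : List (Fin n) → Fin n → Set
  Prev []      c = ⊥
  Prev (p ∷ _) c = c ≡ p

  prev? : ∀ t c → Dec (Prev t c)
  prev? []      c = no λ ()
  prev? (p ∷ _) c = c ≟ p

  Onward : Fin n → List (Fin n) → Fin n → Set
  Onward h t c = Adj D h c × c ≢ h × ¬ Prev t c

  onward? : ∀ h t c → Dec (Onward h t c)
  onward? h t c = adj? h c ×-dec ¬? (c ≟ h) ×-dec ¬? (prev? t c)

  IsPath : Fin n → List (Fin n) → Set
  IsPath h t = Unique (h ∷ t) × Chain D h t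

  path-room-shrinks : ∀ {h t} → IsPath h t → n ∸ length (h ∷ t) < n ∸ length t
  path-room-shrinks (uniq , _) = ∸-monoʳ-< ≤-refl (Unique⇒length≤n uniq)

  Chain-++⁻ˡ : ∀ {x} xs {ys} → Chain D x (xs ++ ys) → Chain D x xs
  Chain-++⁻ˡ []       _               = tt
  Chain-++⁻ˡ (y ∷ xs) (x~y , y-chain) = x~y , Chain-++⁻ˡ xs y-chain

  chord⇒HasCycle : ∀ {h t x} → IsPath h t → Adj D h x → ¬ Prev t x → x ∈ˡ t → HasCycle D
  chord⇒HasCycle {t = q ∷ _} _ _ x≢q (here x≡q) = contradiction x≡q x≢q
  chord⇒HasCycle {h} {q ∷ _} {x} (uniq , h~q , q-chain) h~x _ (there x∈) with ∈-∃++ x∈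
  ... | as , bs , refl =
    x , h ∷ q ∷ as , s≤s (s≤s z≤n) , Unique[xs++x∷ys]⇒Unique[x∷xs] (h ∷ q ∷ as) uniq ,
    Adj-sym h~x , h~q , Chain-++⁻ˡ (as ++ [ x ]) (subst (Chain D q) (sym (++-assoc as [ x ] bs)) q-chain)

  module _ (U : Subset n) where

    Reaches : Fin n → List (Fin n) → Fin n → Set
    Reaches h t c = c ∈ U ⊎ ∃[ d ] (Onward c (h ∷ t) d × d ∈ U)

    reaches? : ∀ h t c → Dec (Reaches h t c)
    reaches? h t c = (c ∈? U) ⊎-dec any? (λ d → onward? c (h ∷ t) d ×-dec d ∈? U)

    record Terminal (h : Fin n) (t : List (Fin n)) : Set where
      constructor terminal
      field
        unreaching : ∀ {c} → Onward h t c → ¬ Reaches h t c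

    MaxDominator : Fin n → Fin n → Set
    MaxDominator h s = h ∈ N⁺ s × (∀ {w} → h ∈ N⁺ w → ∀ {x} → x ∈ N⁺ w → x ∈ U → x ∈ N⁺ s)

    module _ {h t} (h-terminal : Terminal h t) where

      open Terminal h-terminal

      onward-dominated : ∀ {w x} → Onward h t w → x ∈ N⁺ w → x ∈ U → x ≡ h
      onward-dominated {w} {x} w-onward x∈N⁺w x∈U with x ≟ w
      ... | yes refl = contradiction (inj₁ x∈U) (unreaching w-onward)
      ... | no  x≢w with x ≟ h
      ...   | yes x≡h = x≡h
      ...   | no  x≢h = contradiction (inj₂ (x , (inj₁ (∈N⁺⇒arc x∈N⁺w x≢w) , x≢w , x≢h) , x∈U))
                                      (unreaching w-onward)

      end-dominated : ∀ {x} → x ∈ N⁺ h → x ∈ U → x ≡ h ⊎ Prev t x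
      end-dominated {x} x∈N⁺h x∈U with x ≟ h
      ... | yes x≡h = inj₁ x≡h
      ... | no  x≢h with prev? t x
      ...   | yes x-prev = inj₂ x-prev
      ...   | no  ¬x-prev = contradiction (inj₁ x∈U) (unreaching (inj₁ (∈N⁺⇒arc x∈N⁺h x≢h) , x≢h , ¬x-prev))

      dominators : ∀ {w} → h ∈ N⁺ w → w ≡ h ⊎ (Prev t w × Arc D w h) ⊎ Onward h t w
      dominators {w} h∈N⁺w with w ≟ h
      ... | yes w≡h = inj₁ w≡h
      ... | no  w≢h with prev? t w
      ...   | yes w-prev = inj₂ (inj₁ (w-prev , ∈N⁺⇒arc h∈N⁺w (≢-sym w≢h)))
      ...   | no  ¬w-prev = inj₂ (inj₂ (inj₂ (∈N⁺⇒arc h∈N⁺w (≢-sym w≢h)) , w≢h , ¬w-prev))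

      end-maxDominator : (∀ {w} → Prev t w → ¬ Arc D w h) → MaxDominator h h
      end-maxDominator no-arc-in = v∈N⁺[v] h , dominated
        where
        dominated : ∀ {w} → h ∈ N⁺ w → ∀ {x} → x ∈ N⁺ w → x ∈ U → x ∈ N⁺ h
        dominated h∈N⁺w x∈N⁺w x∈U with dominators h∈N⁺w
        ... | inj₁ refl                 = x∈N⁺w
        ... | inj₂ (inj₁ (w-prev , wh)) = contradiction wh (no-arc-in w-prev)
        ... | inj₂ (inj₂ w-onward) with onward-dominated w-onward x∈N⁺w x∈U
        ...   | refl = v∈N⁺[v] h

    prev-maxDominator : ∀ {h p t} → Terminal h (p ∷ t) → Arc D p h → MaxDominator h p
    prev-maxDominator {h} {p} h-terminal ph = arc⇒∈N⁺ ph , dominated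
      where
      dominated : ∀ {w} → h ∈ N⁺ w → ∀ {x} → x ∈ N⁺ w → x ∈ U → x ∈ N⁺ p
      dominated h∈N⁺w x∈N⁺w x∈U with dominators h-terminal h∈N⁺w
      ... | inj₂ (inj₁ (refl , _)) = x∈N⁺w
      ... | inj₂ (inj₂ w-onward) with onward-dominated h-terminal w-onward x∈N⁺w x∈U
      ...   | refl = arc⇒∈N⁺ ph
      dominated h∈N⁺w x∈N⁺w x∈U | inj₁ refl with end-dominated h-terminal x∈N⁺w x∈U
      ... | inj₁ refl = arc⇒∈N⁺ ph
      ... | inj₂ refl = v∈N⁺[v] p

    terminal⇒maxDominator : ∀ {h t} → Terminal h t → ∃[ s ] MaxDominator h s
    terminal⇒maxDominator {h} {[]}    h-terminal = h , end-maxDominator h-terminal λ ()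
    terminal⇒maxDominator {h} {p ∷ _} h-terminal with arc? p h
    ... | yes ph = p , prev-maxDominator h-terminal ph
    ... | no ¬ph = h , end-maxDominator h-terminal λ { refl → ¬ph }

  DualPair : Subset n → Set
  DualPair U = ∃[ B ] ∃[ S ] (B ⊆ U × IsPacking D B × Covers S U × ∣ S ∣ ≤ ∣ B ∣)

  dualPair-step : ∀ {U h s} → h ∈ U → MaxDominator U h s → DualPair (U ─ N⁺ s) → DualPair U
  dualPair-step {U} {h} {s} h∈U (h∈N⁺s , maximal) (B , S , B⊆ , B-packing , S-covers , ∣S∣≤∣B∣) =
    ⁅ h ⁆ ∪ B , ⁅ s ⁆ ∪ S , B′⊆U , B′-packing , S′-covers , ∣S′∣≤∣B′∣
    where
    h∉B : h ∉ B
    h∉B h∈B = x∈p─q⇒x∉q (B⊆ h∈B) h∈N⁺s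

    B′⊆U : ⁅ h ⁆ ∪ B ⊆ U
    B′⊆U x∈ with x∈p∪q⁻ ⁅ h ⁆ B x∈
    ... | inj₁ x∈⁅h⁆ = subst (_∈ U) (sym (x∈⁅y⁆⇒x≡y h x∈⁅h⁆)) h∈U
    ... | inj₂ x∈B   = p─q⊆p U (N⁺ s) (B⊆ x∈B)

    B′-packing : IsPacking D (⁅ h ⁆ ∪ B)
    B′-packing = IsPacking-⁅x⁆∪ B-packing λ h∈N⁺v y∈N⁺v y∈B →
      x∈p─q⇒x∉q (B⊆ y∈B) (maximal h∈N⁺v y∈N⁺v (p─q⊆p U (N⁺ s) (B⊆ y∈B)))

    S′-covers : Covers (⁅ s ⁆ ∪ S) U
    S′-covers {x} x∈U with x ∈? N⁺ s
    ... | yes x∈N⁺s = s , x∈p∪q⁺ (inj₁ (x∈⁅x⁆ s)) , x∈N⁺s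
    ... | no  x∉N⁺s with S-covers (x∈p∧x∉q⇒x∈p─q x∈U x∉N⁺s)
    ...   | s′ , s′∈S , x∈N⁺s′ = s′ , x∈p∪q⁺ (inj₂ s′∈S) , x∈N⁺s′

    ∣S′∣≤∣B′∣ : ∣ ⁅ s ⁆ ∪ S ∣ ≤ ∣ ⁅ h ⁆ ∪ B ∣
    ∣S′∣≤∣B′∣ = ≤-trans (∣⁅x⁆∪p∣≤1+∣p∣ s S)
                  (≤-trans (s≤s ∣S∣≤∣B∣) (p⊂q⇒∣p∣<∣q∣ (q⊆p∪q ⁅ h ⁆ B , h , x∈p∪q⁺ (inj₁ (x∈⁅x⁆ h)) , h∉B)))

  module _ (acyclic : ¬ HasCycle D) where

    open import Data.List.Membership.DecPropositional (_≟_ {n}) using () renaming (_∈?_ to _∈ˡ?_)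

    extend : ∀ {h t c} → IsPath h t → Onward h t c → IsPath c (h ∷ t)
    extend {h} {t} {c} path@(uniq , chain) (h~c , c≢h , ¬c-prev) with c ∈ˡ? t
    ... | yes c∈t = contradiction (chord⇒HasCycle path h~c ¬c-prev c∈t) acyclic
    ... | no  c∉t = ((c≢h ∷ ¬Any⇒All¬ t c∉t) ∷ uniq) , Adj-sym h~c , chain

    ∃terminal : ∀ U → Nonempty U → ∃[ h ] ∃[ t ] (h ∈ U × Terminal U h t)
    ∃terminal U (u , u∈U) = search u∈U (([] ∷ []) , tt) (<-wellFounded _)
      where
      -- Acyclicity keeps every extension a path, so the search stops within n steps.
      search : ∀ {h t} → h ∈ U → IsPath h t → Acc _<_ (n ∸ length t) →
               ∃[ h′ ] ∃[ t′ ] (h′ ∈ U × Terminal U h′ t′)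
      search {h} {t} h∈U path (acc rec) with any? (λ c → onward? h t c ×-dec reaches? U h t c)
      ... | no ¬reach = h , t , h∈U , terminal λ c-onward c-reaches → ¬reach (_ , c-onward , c-reaches)
      ... | yes (c , c-onward , inj₁ c∈U) =
            search c∈U (extend path c-onward) (rec (path-room-shrinks path))
      ... | yes (c , c-onward , inj₂ (d , d-onward , d∈U)) =
            search d∈U (extend path′ d-onward) (rec (<-trans (path-room-shrinks path′) (path-room-shrinks path)))
        where
        path′ : IsPath c (h ∷ t)
        path′ = extend path c-onward

    dualPair : ∀ U → DualPair U
    dualPair U = go U (⊂-wellFounded U)
      where
      go : ∀ U → Acc _⊂_ U → DualPair U
      go U (acc rec) with nonempty? U
      ... | no U-empty = ∅ , ∅ , ⊥⊆ , ∅-packing , (λ x∈U → contradiction (_ , x∈U) U-empty) , ≤-refl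
      ... | yes U-nonempty with ∃terminal U U-nonempty
      ...   | h , t , h∈U , h-terminal with terminal⇒maxDominator U h-terminal
      ...     | s , h-max@(h∈N⁺s , _) =
                dualPair-step h∈U h-max (go (U ─ N⁺ s) (rec (p∩q≢∅⇒p─q⊂p U (N⁺ s) (h , x∈p∩q⁺ (h∈U , h∈N⁺s)))))

theorem5 : ∀ {n} (T : Digraph n) → IsDirectedTree T →
    ∀ (r g : ℕ) → IsPackingNumber T r → IsDominationNumber T g → r ≡ g
theorem5 T (_ , _ , _ , _ , acyclic) r g ((B , B-packing , ∣B∣≡r) , ρ-max) ((S , S-dominating , ∣S∣≡g) , γ-min) =
  ≤-antisym r≤g g≤r
  where
  r≤g : r ≤ g
  r≤g = subst₂ _≤_ ∣B∣≡r ∣S∣≡g (∣packing∣≤∣cover∣ T S B-packing (dominating⇒covers T S-dominating))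

  g≤r : g ≤ r
  g≤r with dualPair T acyclic Full
  ... | B₀ , S₀ , _ , B₀-packing , S₀-covers , ∣S₀∣≤∣B₀∣ =
    ≤-trans (γ-min S₀ (covers⇒dominating T S₀-covers)) (≤-trans ∣S₀∣≤∣B₀∣ (ρ-max B₀ B₀-packing))
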